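{- Let $w \ge 2$ be an integer and suppose we are given $N = 2^w$ identical-looking coins, exactly two of which are counterfeit. Then there is an adaptive weighing strategy using a 5-way scale that is guaranteed to identify both counterfeit coins using at most $w+1$ weighings.
   Context: All real coins have the same weight; the two counterfeit coins have the same weight as each other, which is strictly less than that of a real coin. A weighing on the 5-way scale places the same number of coins on each of two pans. Let $d$ be (number of counterfeit coins on the left pan) minus (number of counterfeit coins on the right pan). The scale reports MUCH LESS if $d \ge 2$, LESS if $d = 1$, EQUAL if $d = 0$, MORE if $d = -1$, and MUCH MORE if $d \le -2$. A strategy is adaptive: the choice of each weighing may depend on the outcomes of the previous ones. -}

module Defs where

open import Data.Nat using (ℕ; zero; suc)
open import Data.Integer using (ℤ; +_; -[1+_]; _⊖_)
open import Data.Fin using (Fin)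
open import Data.Fin.Subset using (Subset; _∩_; ∣_∣; Empty)
open import Relation.Binary.PropositionalEquality using (_≡_)

data Outcome : Set where
  muchLess less equal more muchMore : Outcome

record Weighing (n : ℕ) : Set where
  constructor weighing
  field
    left     : Subset n
    right    : Subset n
    disjoint : Empty (left ∩ right)
    balanced : ∣ left ∣ ≡ ∣ right ∣
open Weighing public

classify : ℤ → Outcome
classify (+ zero)          = equal
classify (+ suc zero)      = less
classify (+ suc (suc _))   = muchLess
classify -[1+ zero ]       = more
classify -[1+ suc _ ]      = muchMore

outcome : ∀ {n} → Weighing n → Subset n → Outcome
outcome W C = classify (∣ left W ∩ C ∣ ⊖ ∣ right W ∩ C ∣)

-- Adaptive strategies on n coins using at most k weighings (decision trees
-- of depth ≤ k). A leaf announces a set of coins (the claimed counterfeits).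
data Strategy (n : ℕ) : ℕ → Set where
  answer : ∀ {k} → Subset n → Strategy n k
  weigh  : ∀ {k} → Weighing n → (Outcome → Strategy n k) → Strategy n (suc k)

run : ∀ {n k} → Strategy n k → Subset n → Subset n
run (answer S)  C = S
run (weigh W f) C = run (f (outcome W C)) C

-- Weigh one half of the coins against the other. If both counterfeits lie in the same half
-- the scale tips by two and we recurse into that half. If it balances there is one
-- counterfeit in each half; weighing the two quarters of the first half against each other
-- puts that counterfeit in a block A and certifies the other quarter G as genuine. From
-- then on, with one counterfeit in A and one in a block B twice as large, the weighing of
-- A₀ ∪ B₀ against A₁ ∪ G gives a different reading for each of the four ways the two
-- counterfeits can lie in the halves of A and B, so a single weighing halves both blocks
-- (and half of G is enough genuine coins for the next round).

module Submission where

open import Defs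
open import Data.Empty using (⊥-elim)
open import Data.Fin using (Fin; zero; suc)
open import Data.Fin.Subset using (Subset; _∪_; _∩_; ⁅_⁆; ∣_∣; ⊥; ⊤; Empty; inside; outside)
open import Data.Fin.Subset.Properties
  using (∉⊥; Empty-unique; ∣⊥∣≡0; ∣⊤∣≡n; ∣p∣≤n; ∣p∣≡n⇒p≡⊤; ∣⁅x⁆∣≡1;
         ∩-identityˡ; ∩-zeroˡ; ∩-zeroʳ; ∪-identityˡ; ∪-identityʳ)
open import Data.Integer using (_⊖_)
open import Data.Nat using (ℕ; zero; suc; _+_; _*_; _^_; _≤_)
open import Data.Nat.Properties using (+-identityʳ; +-comm; +-cancelˡ-≡; <-irrefl)
open import Data.Product using (Σ; _,_)
open import Data.Vec using ([]; _∷_; _++_; splitAt)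
open import Data.Vec.Properties using (zipWith-++)
open import Relation.Binary.PropositionalEquality
  using (_≡_; _≢_; refl; sym; trans; cong; cong₂; subst; module ≡-Reasoning)
open ≡-Reasoning

private variable
  i j k m n : ℕ

∣++∣ : (x : Subset m) (y : Subset n) → ∣ x ++ y ∣ ≡ ∣ x ∣ + ∣ y ∣
∣++∣ []            y = refl
∣++∣ (outside ∷ x) y = ∣++∣ x y
∣++∣ (inside ∷ x)  y = cong suc (∣++∣ x y)

⊥++⊥ : ∀ m → ⊥ {m} ++ ⊥ {n} ≡ ⊥
⊥++⊥ zero    = refl
⊥++⊥ (suc m) = cong (outside ∷_) (⊥++⊥ m)

∣p∣≡0⇒p≡⊥ : (p : Subset n) → ∣ p ∣ ≡ 0 → p ≡ ⊥
∣p∣≡0⇒p≡⊥ []            _     = refl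
∣p∣≡0⇒p≡⊥ (outside ∷ p) ∣p∣≡0 = cong (outside ∷_) (∣p∣≡0⇒p≡⊥ p ∣p∣≡0)

⊥-empty : Empty (⊥ {n})
⊥-empty (_ , x∈⊥) = ∉⊥ x∈⊥

∣⊤∩p∣ : (p : Subset n) → ∣ ⊤ ∩ p ∣ ≡ ∣ p ∣
∣⊤∩p∣ p = cong ∣_∣ (∩-identityˡ p)

∣⊥∩p∣ : (p : Subset n) → ∣ ⊥ ∩ p ∣ ≡ 0
∣⊥∩p∣ {n} p = trans (cong ∣_∣ (∩-zeroˡ p)) (∣⊥∣≡0 n)

∣⁅x⁆∪⁅y⁆∣≡2 : {x y : Fin n} → x ≢ y → ∣ ⁅ x ⁆ ∪ ⁅ y ⁆ ∣ ≡ 2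
∣⁅x⁆∪⁅y⁆∣≡2 {x = zero}  {zero}  x≢y = ⊥-elim (x≢y refl)
∣⁅x⁆∪⁅y⁆∣≡2 {x = zero}  {suc y} _   = cong suc (trans (cong ∣_∣ (∪-identityˡ ⁅ y ⁆)) (∣⁅x⁆∣≡1 y))
∣⁅x⁆∪⁅y⁆∣≡2 {x = suc x} {zero}  _   = cong suc (trans (cong ∣_∣ (∪-identityʳ ⁅ x ⁆)) (∣⁅x⁆∣≡1 x))
∣⁅x⁆∪⁅y⁆∣≡2 {x = suc x} {suc y} x≢y = ∣⁅x⁆∪⁅y⁆∣≡2 (λ x≡y → x≢y (cong suc x≡y))

-- Halves of a coin set

infixr 5 _∥_

-- 2 * n unfolds to n + (n + 0), hence the trailing [].
_∥_ : Subset n → Subset n → Subset (2 * n)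
x ∥ y = x ++ (y ++ [])

data Half : Set where
  front back : Half

place : Half → Subset n → Subset n → Subset (2 * n)
place front x y = x ∥ y
place back  x y = y ∥ x

data Halves {n} : Subset (2 * n) → Set where
  halvesOf : (x y : Subset n) → Halves (x ∥ y)

halves : (s : Subset (2 * n)) → Halves s
halves {n} s with splitAt n s
... | x , r , refl with splitAt n {0} r
...   | y , [] , refl = halvesOf x y

∣∥∣ : (x y : Subset n) → ∣ x ∥ y ∣ ≡ ∣ x ∣ + ∣ y ∣
∣∥∣ x y = trans (∣++∣ x (y ++ [])) (cong (∣ x ∣ +_) (trans (∣++∣ y []) (+-identityʳ ∣ y ∣)))

∣place∣ : ∀ h (x y : Subset n) → ∣ place h x y ∣ ≡ ∣ x ∣ + ∣ y ∣
∣place∣ front x y = ∣∥∣ x y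
∣place∣ back  x y = trans (∣∥∣ y x) (+-comm ∣ y ∣ ∣ x ∣)

∥-∩ : (x y u v : Subset n) → (x ∥ y) ∩ (u ∥ v) ≡ (x ∩ u) ∥ (y ∩ v)
∥-∩ x y u v = trans (zipWith-++ _ x (y ++ []) u (v ++ []))
                    (cong (x ∩ u ++_) (zipWith-++ _ y [] v []))

place-∩ : ∀ h (x y u v : Subset n) → place h x y ∩ place h u v ≡ place h (x ∩ u) (y ∩ v)
place-∩ front x y u v = ∥-∩ x y u v
place-∩ back  x y u v = ∥-∩ y x v u

⊥∥⊥ : ∀ n → ⊥ {n} ∥ ⊥ ≡ ⊥
⊥∥⊥ n = trans (cong (⊥ {n} ++_) (⊥++⊥ n)) (⊥++⊥ n)

place-⊥ : ∀ h n → place h (⊥ {n}) ⊥ ≡ ⊥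
place-⊥ front = ⊥∥⊥
place-⊥ back  = ⊥∥⊥

∣∥-∩∣ : (x y u v : Subset n) → ∣ (x ∥ y) ∩ (u ∥ v) ∣ ≡ ∣ x ∩ u ∣ + ∣ y ∩ v ∣
∣∥-∩∣ x y u v = trans (cong ∣_∣ (∥-∩ x y u v)) (∣∥∣ (x ∩ u) (y ∩ v))

∣place-∩∣ : ∀ h (x y u v : Subset n) → ∣ place h x y ∩ place h u v ∣ ≡ ∣ x ∩ u ∣ + ∣ y ∩ v ∣
∣place-∩∣ h x y u v = trans (cong ∣_∣ (place-∩ h x y u v)) (∣place∣ h (x ∩ u) (y ∩ v))

∣⊤∥⊥∣ : ∀ n → ∣ ⊤ {n} ∥ ⊥ ∣ ≡ n
∣⊤∥⊥∣ n = trans (∣∥∣ (⊤ {n}) ⊥) (trans (cong₂ _+_ (∣⊤∣≡n n) (∣⊥∣≡0 n)) (+-identityʳ n))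

∣⊥∥⊤∣ : ∀ n → ∣ ⊥ {n} ∥ ⊤ ∣ ≡ n
∣⊥∥⊤∣ n = trans (∣∥∣ (⊥ {n}) ⊤) (cong₂ _+_ (∣⊥∣≡0 n) (∣⊤∣≡n n))

⊤∥⊥-∩-⊥∥⊤ : ∀ n → (⊤ {n} ∥ ⊥) ∩ (⊥ {n} ∥ ⊤) ≡ ⊥
⊤∥⊥-∩-⊥∥⊤ n = trans (∥-∩ (⊤ {n}) ⊥ ⊥ ⊤) (trans (cong₂ (_∥_ {n}) (∩-zeroʳ ⊤) (∩-zeroˡ ⊤)) (⊥∥⊥ n))

∣⊤∥⊥-∩∣ : (x y : Subset n) → ∣ (⊤ {n} ∥ ⊥) ∩ (x ∥ y) ∣ ≡ ∣ x ∣
∣⊤∥⊥-∩∣ x y = trans (∣∥-∩∣ ⊤ ⊥ x y) (trans (cong₂ _+_ (∣⊤∩p∣ x) (∣⊥∩p∣ y)) (+-identityʳ ∣ x ∣))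

∣⊥∥⊤-∩∣ : (x y : Subset n) → ∣ (⊥ {n} ∥ ⊤) ∩ (x ∥ y) ∣ ≡ ∣ y ∣
∣⊥∥⊤-∩∣ x y = trans (∣∥-∩∣ ⊥ ⊤ x y) (cong₂ _+_ (∣⊥∩p∣ x) (∣⊤∩p∣ y))

data InHalf (k : ℕ) {n} : Subset (2 * n) → Set where
  inHalf : ∀ h {x : Subset n} → ∣ x ∣ ≡ k → InHalf k (place h x ⊥)

data PairLayout {n} : Subset (2 * n) → Set where
  bothIn  : ∀ h {x : Subset n} → ∣ x ∣ ≡ 2 → PairLayout (place h x ⊥)
  oneEach : {x y : Subset n} → ∣ x ∣ ≡ 1 → ∣ y ∣ ≡ 1 → PairLayout (x ∥ y)

singletonInHalf : (s : Subset (2 * n)) → ∣ s ∣ ≡ 1 → InHalf 1 s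
singletonInHalf {n} s ∣s∣≡1 with halves {n} s
... | halvesOf x y with ∣ x ∣ in ∣x∣≡k | trans (sym (∣∥∣ x y)) ∣s∣≡1
...   | 0 | ∣y∣≡1   rewrite ∣p∣≡0⇒p≡⊥ x ∣x∣≡k = inHalf back {y} ∣y∣≡1
...   | 1 | 1+∣y∣≡1 rewrite ∣p∣≡0⇒p≡⊥ y (+-cancelˡ-≡ 1 _ 0 1+∣y∣≡1) = inHalf front {x} ∣x∣≡k

pairLayout : (s : Subset (2 * n)) → ∣ s ∣ ≡ 2 → PairLayout s
pairLayout {n} s ∣s∣≡2 with halves {n} s
... | halvesOf x y with ∣ x ∣ in ∣x∣≡k | trans (sym (∣∥∣ x y)) ∣s∣≡2
...   | 0 | ∣y∣≡2   rewrite ∣p∣≡0⇒p≡⊥ x ∣x∣≡k = bothIn back {y} ∣y∣≡2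
...   | 1 | 1+∣y∣≡2 = oneEach {x = x} {y} ∣x∣≡k (+-cancelˡ-≡ 1 _ 1 1+∣y∣≡2)
...   | 2 | 2+∣y∣≡2 rewrite ∣p∣≡0⇒p≡⊥ y (+-cancelˡ-≡ 2 _ 0 2+∣y∣≡2) = bothIn front {x} ∣x∣≡k

-- Weighings

mkWeighing : (L R : Subset n) → L ∩ R ≡ ⊥ → ∣ L ∣ ≡ ∣ R ∣ → Weighing n
mkWeighing L R L∩R≡⊥ = weighing L R (subst Empty (sym L∩R≡⊥) ⊥-empty)

outcome-by-counts : (W : Weighing n) {C : Subset n} →
  ∣ left W ∩ C ∣ ≡ i → ∣ right W ∩ C ∣ ≡ j → outcome W C ≡ classify (i ⊖ j)
outcome-by-counts W = cong₂ (λ l r → classify (l ⊖ r))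

weigh-identifies : (W : Weighing n) (f : Outcome → Strategy n k) {C : Subset n} {o : Outcome} →
  outcome W C ≡ o → run (f o) C ≡ C → run (weigh W f) C ≡ C
weigh-identifies W f {C} reading identifies = trans (cong (λ o → run (f o) C) reading) identifies

halvesWeighing : ∀ n → Weighing (2 * n)
halvesWeighing n = mkWeighing (⊤ {n} ∥ ⊥) (⊥ {n} ∥ ⊤) (⊤∥⊥-∩-⊥∥⊤ n) (trans (∣⊤∥⊥∣ n) (sym (∣⊥∥⊤∣ n)))

outcome-halves : (x y : Subset n) → ∣ x ∣ ≡ i → ∣ y ∣ ≡ j →
  outcome (halvesWeighing n) (x ∥ y) ≡ classify (i ⊖ j)
outcome-halves {n} x y ∣x∣≡i ∣y∣≡j = outcome-by-counts (halvesWeighing n)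
  (trans (∣⊤∥⊥-∩∣ x y) ∣x∣≡i) (trans (∣⊥∥⊤-∩∣ x y) ∣y∣≡j)

-- A = A₀ ∥ A₁ sits in half h of the first half, next to a block G of coins known to be
-- genuine; B = B₀ ∥ B₁ is the second half.
referenceWeighing : Half → ∀ n → Weighing (2 * (2 * (2 * n)))
referenceWeighing h n = mkWeighing L R disjoint′ balanced′
  where
  A₀ A₁ G : Subset (2 * n)
  A₀ = ⊤ {n} ∥ ⊥
  A₁ = ⊥ {n} ∥ ⊤
  G  = ⊤

  B₀ : Subset (2 * (2 * n))
  B₀ = ⊤ {2 * n} ∥ ⊥

  L R : Subset (2 * (2 * (2 * n)))
  L = place h A₀ ⊥ ∥ B₀
  R = place h A₁ G ∥ ⊥

  disjoint′ : L ∩ R ≡ ⊥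
  disjoint′ = begin
    L ∩ R                                      ≡⟨ ∥-∩ (place h A₀ ⊥) B₀ (place h A₁ G) ⊥ ⟩
    (place h A₀ ⊥ ∩ place h A₁ G) ∥ (B₀ ∩ ⊥)   ≡⟨ cong₂ _∥_ (place-∩ h A₀ ⊥ A₁ G) (∩-zeroʳ B₀) ⟩
    place h (A₀ ∩ A₁) (⊥ ∩ G) ∥ ⊥              ≡⟨ cong (_∥ ⊥) (cong₂ (place h) (⊤∥⊥-∩-⊥∥⊤ n) (∩-zeroˡ G)) ⟩
    place h ⊥ ⊥ ∥ ⊥                            ≡⟨ cong (_∥ ⊥) (place-⊥ h (2 * n)) ⟩
    ⊥ {2 * (2 * n)} ∥ ⊥                        ≡⟨ ⊥∥⊥ (2 * (2 * n)) ⟩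
    ⊥                                          ∎

  balanced′ : ∣ L ∣ ≡ ∣ R ∣
  balanced′ = begin
    ∣ L ∣                                ≡⟨ ∣∥∣ (place h A₀ ⊥) B₀ ⟩
    ∣ place h A₀ ⊥ ∣ + ∣ B₀ ∣            ≡⟨ cong (_+ ∣ B₀ ∣) (∣place∣ h A₀ ⊥) ⟩
    ∣ A₀ ∣ + ∣ ⊥ {2 * n} ∣ + ∣ B₀ ∣      ≡⟨ cong₂ _+_ (cong₂ _+_ (∣⊤∥⊥∣ n) (∣⊥∣≡0 (2 * n))) (∣⊤∥⊥∣ (2 * n)) ⟩
    n + 0 + 2 * n                        ≡⟨ cong (_+ 2 * n) (+-identityʳ n) ⟩
    n + 2 * n                            ≡⟨ +-identityʳ _ ⟨
    n + 2 * n + 0                        ≡⟨ cong₂ _+_ (cong₂ _+_ (∣⊥∥⊤∣ n) (∣⊤∣≡n (2 * n))) (∣⊥∣≡0 (2 * (2 * n))) ⟨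
    ∣ A₁ ∣ + ∣ G ∣ + ∣ ⊥ {2 * (2 * n)} ∣ ≡⟨ cong (_+ ∣ ⊥ {2 * (2 * n)} ∣) (∣place∣ h A₁ G) ⟨
    ∣ place h A₁ G ∣ + ∣ ⊥ {2 * (2 * n)} ∣ ≡⟨ ∣∥∣ (place h A₁ G) ⊥ ⟨
    ∣ R ∣                                ∎

outcome-reference : ∀ h {a₀ a₁ : Subset n} {c₀ c₁ : Subset (2 * n)} →
  ∣ a₀ ∣ ≡ i → ∣ a₁ ∣ ≡ j → ∣ c₀ ∣ ≡ k →
  outcome (referenceWeighing h n) (place h (a₀ ∥ a₁) ⊥ ∥ (c₀ ∥ c₁)) ≡ classify ((i + k) ⊖ j)
outcome-reference {n} {i} {j} {k} h {a₀} {a₁} {c₀} {c₁} ∣a₀∣≡i ∣a₁∣≡j ∣c₀∣≡k =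
  outcome-by-counts (referenceWeighing h n) left-count right-count
  where
  left-count : ∣ left (referenceWeighing h n) ∩ (place h (a₀ ∥ a₁) ⊥ ∥ (c₀ ∥ c₁)) ∣ ≡ i + k
  left-count = begin
    _                                                   ≡⟨ ∣∥-∩∣ (place h (⊤ {n} ∥ ⊥) ⊥) (⊤ {2 * n} ∥ ⊥) (place h (a₀ ∥ a₁) ⊥) (c₀ ∥ c₁) ⟩
    ∣ place h (⊤ {n} ∥ ⊥) ⊥ ∩ place h (a₀ ∥ a₁) ⊥ ∣ + ∣ (⊤ {2 * n} ∥ ⊥) ∩ (c₀ ∥ c₁) ∣
      ≡⟨ cong₂ _+_ (∣place-∩∣ h (⊤ {n} ∥ ⊥) ⊥ (a₀ ∥ a₁) ⊥) (∣⊤∥⊥-∩∣ c₀ c₁) ⟩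
    ∣ (⊤ {n} ∥ ⊥) ∩ (a₀ ∥ a₁) ∣ + ∣ ⊥ {2 * n} ∩ ⊥ ∣ + ∣ c₀ ∣
      ≡⟨ cong (_+ ∣ c₀ ∣) (cong₂ _+_ (∣⊤∥⊥-∩∣ a₀ a₁) (∣⊥∩p∣ (⊥ {2 * n}))) ⟩
    ∣ a₀ ∣ + 0 + ∣ c₀ ∣                                 ≡⟨ cong₂ _+_ (trans (+-identityʳ ∣ a₀ ∣) ∣a₀∣≡i) ∣c₀∣≡k ⟩
    i + k                                               ∎

  right-count : ∣ right (referenceWeighing h n) ∩ (place h (a₀ ∥ a₁) ⊥ ∥ (c₀ ∥ c₁)) ∣ ≡ j
  right-count = begin
    _                                                   ≡⟨ ∣∥-∩∣ (place h (⊥ {n} ∥ ⊤) ⊤) ⊥ (place h (a₀ ∥ a₁) ⊥) (c₀ ∥ c₁) ⟩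
    ∣ place h (⊥ {n} ∥ ⊤) ⊤ ∩ place h (a₀ ∥ a₁) ⊥ ∣ + ∣ ⊥ ∩ (c₀ ∥ c₁) ∣
      ≡⟨ cong₂ _+_ (∣place-∩∣ h (⊥ {n} ∥ ⊤) ⊤ (a₀ ∥ a₁) ⊥) (∣⊥∩p∣ (c₀ ∥ c₁)) ⟩
    ∣ (⊥ {n} ∥ ⊤) ∩ (a₀ ∥ a₁) ∣ + ∣ ⊤ ∩ ⊥ {2 * n} ∣ + 0
      ≡⟨ cong (_+ 0) (cong₂ _+_ (∣⊥∥⊤-∩∣ a₀ a₁) (trans (∣⊤∩p∣ (⊥ {2 * n})) (∣⊥∣≡0 (2 * n)))) ⟩
    ∣ a₁ ∣ + 0 + 0                                      ≡⟨ trans (+-identityʳ _) (trans (+-identityʳ _) ∣a₁∣≡j) ⟩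
    j                                                   ∎

-- Embeddings of coin sets

data Thin : ℕ → ℕ → Set where
  done : Thin 0 0
  keep : Thin m n → Thin (suc m) (suc n)
  skip : Thin m n → Thin m (suc n)

lift : Thin m n → Subset m → Subset n
lift done     []      = []
lift (keep e) (x ∷ p) = x ∷ lift e p
lift (skip e) p       = outside ∷ lift e p

lift-∩ : (e : Thin m n) (p q : Subset m) → lift e (p ∩ q) ≡ lift e p ∩ lift e q
lift-∩ done     []      []      = refl
lift-∩ (keep e) (x ∷ p) (y ∷ q) = cong (_ ∷_) (lift-∩ e p q)
lift-∩ (skip e) p       q       = cong (outside ∷_) (lift-∩ e p q)

lift-⊥ : (e : Thin m n) → lift e ⊥ ≡ ⊥
lift-⊥ done     = refl
lift-⊥ (keep e) = cong (outside ∷_) (lift-⊥ e)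
lift-⊥ (skip e) = cong (outside ∷_) (lift-⊥ e)

∣lift∣ : (e : Thin m n) (p : Subset m) → ∣ lift e p ∣ ≡ ∣ p ∣
∣lift∣ done     []            = refl
∣lift∣ (keep e) (outside ∷ p) = ∣lift∣ e p
∣lift∣ (keep e) (inside ∷ p)  = cong suc (∣lift∣ e p)
∣lift∣ (skip e) p             = ∣lift∣ e p

liftWeighing : Thin m n → Weighing m → Weighing n
liftWeighing e W = mkWeighing (lift e (left W)) (lift e (right W)) disjoint′ balanced′
  where
  disjoint′ : lift e (left W) ∩ lift e (right W) ≡ ⊥
  disjoint′ = begin
    lift e (left W) ∩ lift e (right W) ≡⟨ lift-∩ e (left W) (right W) ⟨
    lift e (left W ∩ right W)          ≡⟨ cong (lift e) (Empty-unique (disjoint W)) ⟩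
    lift e ⊥                           ≡⟨ lift-⊥ e ⟩
    ⊥                                  ∎

  balanced′ : ∣ lift e (left W) ∣ ≡ ∣ lift e (right W) ∣
  balanced′ = trans (∣lift∣ e (left W)) (trans (balanced W) (sym (∣lift∣ e (right W))))

liftStrategy : Thin m n → Strategy m k → Strategy n k
liftStrategy e (answer S)  = answer (lift e S)
liftStrategy e (weigh W f) = weigh (liftWeighing e W) (λ o → liftStrategy e (f o))

outcome-lift : (e : Thin m n) (W : Weighing m) (C : Subset m) →
  outcome (liftWeighing e W) (lift e C) ≡ outcome W C
outcome-lift e W C = outcome-by-counts (liftWeighing e W) (∣lift-∩∣ (left W)) (∣lift-∩∣ (right W))
  where
  ∣lift-∩∣ : (p : Subset _) → ∣ lift e p ∩ lift e C ∣ ≡ ∣ p ∩ C ∣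
  ∣lift-∩∣ p = trans (cong ∣_∣ (sym (lift-∩ e p C))) (∣lift∣ e (p ∩ C))

run-liftStrategy : (e : Thin m n) (s : Strategy m k) (C : Subset m) →
  run (liftStrategy e s) (lift e C) ≡ lift e (run s C)
run-liftStrategy e (answer S)  C = refl
run-liftStrategy e (weigh W f) C rewrite outcome-lift e W C = run-liftStrategy e (f (outcome W C)) C

liftStrategy-identifies : (e : Thin m n) (s : Strategy m k) {C′ : Subset m} {C : Subset n} →
  lift e C′ ≡ C → run s C′ ≡ C′ → run (liftStrategy e s) C ≡ C
liftStrategy-identifies e s {C′} refl identifies = trans (run-liftStrategy e s C′) (cong (lift e) identifies)

idᵗ : ∀ n → Thin n n
idᵗ zero    = done
idᵗ (suc n) = keep (idᵗ n)

emptyᵗ : ∀ n → Thin 0 n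
emptyᵗ zero    = done
emptyᵗ (suc n) = skip (emptyᵗ n)

infixr 5 _++ᵗ_ _∥ᵗ_

_++ᵗ_ : ∀ {m′ n′} → Thin m n → Thin m′ n′ → Thin (m + m′) (n + n′)
done   ++ᵗ e′ = e′
keep e ++ᵗ e′ = keep (e ++ᵗ e′)
skip e ++ᵗ e′ = skip (e ++ᵗ e′)

padʳ : ∀ k → Thin m n → Thin m (n + k)
padʳ k done     = emptyᵗ k
padʳ k (keep e) = keep (padʳ k e)
padʳ k (skip e) = skip (padʳ k e)

_∥ᵗ_ : Thin m n → Thin m n → Thin (2 * m) (2 * n)
e ∥ᵗ e′ = e ++ᵗ e′ ++ᵗ done

placeᵗ : Half → Thin m n → Thin m n → Thin (2 * m) (2 * n)
placeᵗ front e e′ = e ∥ᵗ e′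
placeᵗ back  e e′ = e′ ∥ᵗ e

intoHalf : Half → ∀ n → Thin n (2 * n)
intoHalf front n = padʳ (n + 0) (idᵗ n)
intoHalf back  n = emptyᵗ n ++ᵗ padʳ 0 (idᵗ n)

lift-idᵗ : (p : Subset n) → lift (idᵗ n) p ≡ p
lift-idᵗ []      = refl
lift-idᵗ (x ∷ p) = cong (x ∷_) (lift-idᵗ p)

lift-emptyᵗ : ∀ n → lift (emptyᵗ n) [] ≡ ⊥
lift-emptyᵗ zero    = refl
lift-emptyᵗ (suc n) = cong (outside ∷_) (lift-emptyᵗ n)

lift-++ᵗ : ∀ {m′ n′} (e : Thin m n) (e′ : Thin m′ n′) (p : Subset m) (q : Subset m′) →
  lift (e ++ᵗ e′) (p ++ q) ≡ lift e p ++ lift e′ q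
lift-++ᵗ done     e′ []      q = refl
lift-++ᵗ (keep e) e′ (x ∷ p) q = cong (x ∷_) (lift-++ᵗ e e′ p q)
lift-++ᵗ (skip e) e′ p       q = cong (outside ∷_) (lift-++ᵗ e e′ p q)

lift-padʳ : ∀ k (e : Thin m n) (p : Subset m) → lift (padʳ k e) p ≡ lift e p ++ ⊥
lift-padʳ k done     []      = lift-emptyᵗ k
lift-padʳ k (keep e) (x ∷ p) = cong (x ∷_) (lift-padʳ k e p)
lift-padʳ k (skip e) p       = cong (outside ∷_) (lift-padʳ k e p)

lift-∥ᵗ : (e e′ : Thin m n) (p q : Subset m) → lift (e ∥ᵗ e′) (p ∥ q) ≡ lift e p ∥ lift e′ q
lift-∥ᵗ e e′ p q = trans (lift-++ᵗ e (e′ ++ᵗ done) p (q ++ [])) (cong (lift e p ++_) (lift-++ᵗ e′ done q []))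

lift-placeᵗ : ∀ h (e e′ : Thin m n) (p q : Subset m) →
  lift (placeᵗ h e e′) (place h p q) ≡ place h (lift e p) (lift e′ q)
lift-placeᵗ front e e′ p q = lift-∥ᵗ e e′ p q
lift-placeᵗ back  e e′ p q = lift-∥ᵗ e′ e q p

lift-intoHalf : ∀ h n (p : Subset n) → lift (intoHalf h n) p ≡ place h p ⊥
lift-intoHalf front n p = begin
  lift (padʳ (n + 0) (idᵗ n)) p ≡⟨ lift-padʳ (n + 0) (idᵗ n) p ⟩
  lift (idᵗ n) p ++ ⊥           ≡⟨ cong₂ _++_ (lift-idᵗ p) (sym (⊥++⊥ n)) ⟩
  p ∥ ⊥                         ∎
lift-intoHalf back n p = begin
  lift (emptyᵗ n ++ᵗ padʳ 0 (idᵗ n)) ([] ++ p)       ≡⟨ lift-++ᵗ (emptyᵗ n) (padʳ 0 (idᵗ n)) [] p ⟩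
  lift (emptyᵗ n) [] ++ lift (padʳ 0 (idᵗ n)) p       ≡⟨ cong₂ _++_ (lift-emptyᵗ n) (lift-padʳ 0 (idᵗ n) p) ⟩
  ⊥ {n} ++ (lift (idᵗ n) p ++ [])                     ≡⟨ cong (λ q → ⊥ ∥ q) (lift-idᵗ p) ⟩
  ⊥ ∥ p                                               ∎

outcome-intoHalf : ∀ h (W : Weighing n) (u v : Subset n) →
  outcome (liftWeighing (intoHalf h n) W) (place h u v) ≡ outcome W u
outcome-intoHalf {n} h W u v =
  outcome-by-counts (liftWeighing (intoHalf h n) W) (∣lifted-∩∣ (left W)) (∣lifted-∩∣ (right W))
  where
  ∣lifted-∩∣ : (p : Subset n) → ∣ lift (intoHalf h n) p ∩ place h u v ∣ ≡ ∣ p ∩ u ∣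
  ∣lifted-∩∣ p = begin
    ∣ lift (intoHalf h n) p ∩ place h u v ∣ ≡⟨ cong (λ q → ∣ q ∩ place h u v ∣) (lift-intoHalf h n p) ⟩
    ∣ place h p ⊥ ∩ place h u v ∣          ≡⟨ ∣place-∩∣ h p ⊥ u v ⟩
    ∣ p ∩ u ∣ + ∣ ⊥ ∩ v ∣                  ≡⟨ cong (∣ p ∩ u ∣ +_) (∣⊥∩p∣ v) ⟩
    ∣ p ∩ u ∣ + 0                          ≡⟨ +-identityʳ _ ⟩
    ∣ p ∩ u ∣                              ∎

-- Search strategies

lighter : Half → Outcome
lighter front = less
lighter back  = more

byLighterHalf : (Half → Strategy n k) → Outcome → Strategy n k
byLighterHalf s less = s front
byLighterHalf s more = s back
byLighterHalf s _    = answer ⊥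

byLighterHalf-lighter : (s : Half → Strategy n k) (h : Half) → byLighterHalf s (lighter h) ≡ s h
byLighterHalf-lighter s front = refl
byLighterHalf-lighter s back  = refl

outcome-halves-singleton : ∀ h (x : Subset n) → ∣ x ∣ ≡ 1 → outcome (halvesWeighing n) (place h x ⊥) ≡ lighter h
outcome-halves-singleton {n} front x ∣x∣≡1 = outcome-halves x ⊥ ∣x∣≡1 (∣⊥∣≡0 n)
outcome-halves-singleton {n} back  x ∣x∣≡1 = outcome-halves ⊥ x (∣⊥∣≡0 n) ∣x∣≡1

quadrant : Half → Half → Outcome
quadrant front front = muchLess
quadrant front back  = less
quadrant back  front = equal
quadrant back  back  = more

byQuadrant : (Half → Half → Strategy n k) → Outcome → Strategy n k
byQuadrant s muchLess = s front front
byQuadrant s less     = s front back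
byQuadrant s equal    = s back front
byQuadrant s more     = s back back
byQuadrant s muchMore = answer ⊥

byQuadrant-quadrant : (s : Half → Half → Strategy n k) (i j : Half) → byQuadrant s (quadrant i j) ≡ s i j
byQuadrant-quadrant s front front = refl
byQuadrant-quadrant s front back  = refl
byQuadrant-quadrant s back  front = refl
byQuadrant-quadrant s back  back  = refl

outcome-quadrant : ∀ h i j {a : Subset n} {c : Subset (2 * n)} → ∣ a ∣ ≡ 1 → ∣ c ∣ ≡ 1 →
  outcome (referenceWeighing h n) (place h (place i a ⊥) ⊥ ∥ place j c ⊥) ≡ quadrant i j
outcome-quadrant {n} h front front {a} {c} ∣a∣≡1 ∣c∣≡1 =
  outcome-reference h {a} {⊥} {c} {⊥} ∣a∣≡1 (∣⊥∣≡0 n) ∣c∣≡1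
outcome-quadrant {n} h front back {a} {c} ∣a∣≡1 _ =
  outcome-reference h {a} {⊥} {⊥} {c} ∣a∣≡1 (∣⊥∣≡0 n) (∣⊥∣≡0 (2 * n))
outcome-quadrant {n} h back front {a} {c} ∣a∣≡1 ∣c∣≡1 =
  outcome-reference h {⊥} {a} {c} {⊥} (∣⊥∣≡0 n) ∣a∣≡1 ∣c∣≡1
outcome-quadrant {n} h back back {a} {c} ∣a∣≡1 _ =
  outcome-reference h {⊥} {a} {⊥} {c} (∣⊥∣≡0 n) ∣a∣≡1 (∣⊥∣≡0 (2 * n))

descent : Half → Half → Half → ∀ n → Thin (2 * (2 * n)) (2 * (2 * (2 * n)))
descent h i j n = placeᵗ h (intoHalf i n) (intoHalf front n) ∥ᵗ intoHalf j (2 * n)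

lift-descent : ∀ h i j (a : Subset n) (c : Subset (2 * n)) →
  lift (descent h i j n) (place h a ⊥ ∥ c) ≡ place h (place i a ⊥) ⊥ ∥ place j c ⊥
lift-descent {n} h i j a c = begin
  lift (descent h i j n) (place h a ⊥ ∥ c)
    ≡⟨ lift-∥ᵗ (placeᵗ h (intoHalf i n) (intoHalf front n)) (intoHalf j (2 * n)) (place h a ⊥) c ⟩
  lift (placeᵗ h (intoHalf i n) (intoHalf front n)) (place h a ⊥) ∥ lift (intoHalf j (2 * n)) c
    ≡⟨ cong₂ _∥_ (lift-placeᵗ h (intoHalf i n) (intoHalf front n) a ⊥) (lift-intoHalf j (2 * n) c) ⟩
  place h (lift (intoHalf i n) a) (lift (intoHalf front n) ⊥) ∥ place j c ⊥
    ≡⟨ cong (_∥ place j c ⊥) (cong₂ (place h) (lift-intoHalf i n a) (lift-⊥ (intoHalf front n))) ⟩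
  place h (place i a ⊥) ⊥ ∥ place j c ⊥
    ∎

unevenPairSearch : Half → ∀ p → Strategy (2 ^ suc (suc p)) (suc p)
unevenPairSearch h zero =
  weigh (liftWeighing (intoHalf back 2) (halvesWeighing 1))
        (byLighterHalf λ j → answer (place h (⊤ {1}) ⊥ ∥ place j (⊤ {1}) ⊥))
unevenPairSearch h (suc p) =
  weigh (referenceWeighing h (2 ^ p))
        (byQuadrant λ i j → liftStrategy (descent h i j (2 ^ p)) (unevenPairSearch h p))

run-unevenPairSearch : ∀ h p (a : Subset (2 ^ p)) (c : Subset (2 ^ suc p)) → ∣ a ∣ ≡ 1 → ∣ c ∣ ≡ 1 →
  run (unevenPairSearch h p) (place h a ⊥ ∥ c) ≡ place h a ⊥ ∥ c
run-unevenPairSearch h zero a c ∣a∣≡1 ∣c∣≡1 with singletonInHalf {1} c ∣c∣≡1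
... | inHalf j {c′} ∣c′∣≡1 =
  weigh-identifies (liftWeighing (intoHalf back 2) (halvesWeighing 1)) (byLighterHalf conclude)
    (trans (outcome-intoHalf back (halvesWeighing 1) (place j c′ ⊥) (place h a ⊥))
           (outcome-halves-singleton j c′ ∣c′∣≡1))
    (trans (cong (λ s → run s (place h a ⊥ ∥ place j c′ ⊥)) (byLighterHalf-lighter conclude j))
           (cong₂ (λ a c → place h a ⊥ ∥ place j c ⊥) (sym (∣p∣≡n⇒p≡⊤ {p = a} ∣a∣≡1)) (sym (∣p∣≡n⇒p≡⊤ {p = c′} ∣c′∣≡1))))
  where
  conclude : Half → Strategy 4 0
  conclude j = answer (place h (⊤ {1}) ⊥ ∥ place j (⊤ {1}) ⊥)
run-unevenPairSearch h (suc p) a c ∣a∣≡1 ∣c∣≡1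
  with singletonInHalf {2 ^ p} a ∣a∣≡1 | singletonInHalf {2 ^ suc p} c ∣c∣≡1
... | inHalf i {a′} ∣a′∣≡1 | inHalf j {c′} ∣c′∣≡1 =
  weigh-identifies (referenceWeighing h (2 ^ p)) (byQuadrant descend)
    (outcome-quadrant h i j ∣a′∣≡1 ∣c′∣≡1)
    (trans (cong (λ s → run s (place h (place i a′ ⊥) ⊥ ∥ place j c′ ⊥)) (byQuadrant-quadrant descend i j))
           (liftStrategy-identifies (descent h i j (2 ^ p)) (unevenPairSearch h p) (lift-descent h i j a′ c′)
                                    (run-unevenPairSearch h p a′ c′ ∣a′∣≡1 ∣c′∣≡1)))
  where
  descend : Half → Half → Strategy (2 ^ suc (suc (suc p))) (suc p)
  descend i j = liftStrategy (descent h i j (2 ^ p)) (unevenPairSearch h p)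

splitPairSearch : ∀ p → Strategy (2 ^ suc p) (suc p)
splitPairSearch zero    = answer ⊤
splitPairSearch (suc p) =
  weigh (liftWeighing (intoHalf front (2 ^ suc p)) (halvesWeighing (2 ^ p)))
        (byLighterHalf λ h → unevenPairSearch h p)

run-splitPairSearch : ∀ p (x y : Subset (2 ^ p)) → ∣ x ∣ ≡ 1 → ∣ y ∣ ≡ 1 →
  run (splitPairSearch p) (x ∥ y) ≡ x ∥ y
run-splitPairSearch zero x y ∣x∣≡1 ∣y∣≡1 = cong₂ _∥_ (sym (∣p∣≡n⇒p≡⊤ {p = x} ∣x∣≡1)) (sym (∣p∣≡n⇒p≡⊤ {p = y} ∣y∣≡1))
run-splitPairSearch (suc p) x y ∣x∣≡1 ∣y∣≡1 with singletonInHalf {2 ^ p} x ∣x∣≡1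
... | inHalf h {x′} ∣x′∣≡1 =
  weigh-identifies (liftWeighing (intoHalf front (2 ^ suc p)) (halvesWeighing (2 ^ p)))
    (byLighterHalf λ h → unevenPairSearch h p)
    (trans (outcome-intoHalf front (halvesWeighing (2 ^ p)) (place h x′ ⊥) y)
           (outcome-halves-singleton h x′ ∣x′∣≡1))
    (trans (cong (λ s → run s (place h x′ ⊥ ∥ y)) (byLighterHalf-lighter (λ h → unevenPairSearch h p) h))
           (run-unevenPairSearch h p x′ y ∣x′∣≡1 ∣y∣≡1))

pairSearch : ∀ p → Strategy (2 ^ p) (suc p)
afterHalving : ∀ p → Outcome → Strategy (2 ^ suc p) (suc p)

pairSearch zero    = answer ⊥
pairSearch (suc p) = weigh (halvesWeighing (2 ^ p)) (afterHalving p)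

afterHalving p muchLess = liftStrategy (intoHalf front (2 ^ p)) (pairSearch p)
afterHalving p equal    = splitPairSearch p
afterHalving p muchMore = liftStrategy (intoHalf back (2 ^ p)) (pairSearch p)
afterHalving p _        = answer ⊥

run-pairSearch : ∀ p (s : Subset (2 ^ p)) → ∣ s ∣ ≡ 2 → run (pairSearch p) s ≡ s
run-pairSearch zero s ∣s∣≡2 = ⊥-elim (<-irrefl refl (subst (_≤ 1) ∣s∣≡2 (∣p∣≤n s)))
run-pairSearch (suc p) s ∣s∣≡2 with pairLayout {2 ^ p} s ∣s∣≡2
... | bothIn front {x} ∣x∣≡2 =
  weigh-identifies (halvesWeighing (2 ^ p)) (afterHalving p) (outcome-halves x ⊥ ∣x∣≡2 (∣⊥∣≡0 (2 ^ p)))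
    (liftStrategy-identifies (intoHalf front (2 ^ p)) (pairSearch p) (lift-intoHalf front (2 ^ p) x) (run-pairSearch p x ∣x∣≡2))
... | bothIn back {x} ∣x∣≡2 =
  weigh-identifies (halvesWeighing (2 ^ p)) (afterHalving p) (outcome-halves ⊥ x (∣⊥∣≡0 (2 ^ p)) ∣x∣≡2)
    (liftStrategy-identifies (intoHalf back (2 ^ p)) (pairSearch p) (lift-intoHalf back (2 ^ p) x) (run-pairSearch p x ∣x∣≡2))
... | oneEach {x} {y} ∣x∣≡1 ∣y∣≡1 =
  weigh-identifies (halvesWeighing (2 ^ p)) (afterHalving p) (outcome-halves x y ∣x∣≡1 ∣y∣≡1)
    (run-splitPairSearch p x y ∣x∣≡1 ∣y∣≡1)

-- The strategy works for every w.
mainTheorem1 : (w : ℕ) → 2 ≤ w →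
    Σ (Strategy (2 ^ w) (suc w)) (λ s →
      (a b : Fin (2 ^ w)) → a ≢ b →
        run s (⁅ a ⁆ ∪ ⁅ b ⁆) ≡ ⁅ a ⁆ ∪ ⁅ b ⁆)
mainTheorem1 w _ = pairSearch w , λ a b a≢b → run-pairSearch w (⁅ a ⁆ ∪ ⁅ b ⁆) (∣⁅x⁆∪⁅y⁆∣≡2 a≢b)
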